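{- Let $G$ be a finite undirected graph and let $c \geq 4|E(G)| - |V(G)|$ be a positive integer. In any candy-passing game on $G$ with $c$ candies, there is at least one vertex $v_* \in V(G)$ which passes candy in every round.
   Context: The candy-passing game on a graph $G$: initially $c>0$ candies are distributed among the vertices of $G$ (each vertex holds a nonnegative integer number of candies). The game proceeds in rounds $t=1,2,\ldots$. In each round, simultaneously, every vertex $v$ that at the beginning of the round holds at least $\deg(v)$ candies passes one candy to each of its neighbors (we say $v$ passes candy in that round); a vertex holding fewer than $\deg(v)$ candies at the beginning of the round does nothing. -}

module Defs where

open import Data.Nat using (ℕ; zero; suc; _+_; _*_; _∸_; _≤_; _≤ᵇ_)
open import Data.Bool using (Bool; true; false; if_then_else_)
open import Data.Fin using (Fin)
open import Data.List using (List; map)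
open import Data.Nat.ListAction using (sum)
open import Data.List using () renaming (allFin to allFinL)
open import Relation.Binary.PropositionalEquality using (_≡_)

record Graph (n : ℕ) : Set where
  field
    adj     : Fin n → Fin n → Bool
    symm    : ∀ u v → adj u v ≡ adj v u
    irrefl  : ∀ v → adj v v ≡ false
open Graph public

vertices : (n : ℕ) → List (Fin n)
vertices n = allFinL n

Σv : {n : ℕ} → (Fin n → ℕ) → ℕ
Σv {n} f = sum (map f (vertices n))

deg : {n : ℕ} → Graph n → Fin n → ℕ
deg G v = Σv (λ u → if adj G v u then 1 else 0)

-- |E(G)| = (sum of degrees) / 2 ; we use twice the number of edges
-- (handshake: 2|E| = Σ deg), so no division is needed.
twiceEdges : {n : ℕ} → Graph n → ℕ
twiceEdges G = Σv (deg G)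

-- A configuration: number of candies on each vertex.
Config : ℕ → Set
Config n = Fin n → ℕ

total : {n : ℕ} → Config n → ℕ
total x = Σv x

passes? : {n : ℕ} → Graph n → Config n → Fin n → Bool
passes? G x v = deg G v ≤ᵇ x v

step : {n : ℕ} → Graph n → Config n → Config n
step G x v =
  (x v ∸ (if passes? G x v then deg G v else 0))
  + Σv (λ u → if adj G u v then (if passes? G x u then 1 else 0) else 0)

-- configuration at the beginning of round t+1 (i.e. after t rounds)
after : {n : ℕ} → Graph n → Config n → ℕ → Config n
after G x zero    = x
after G x (suc t) = step G (after G x t)

-- v passes candy in round t+1 (t = 0,1,2,...)
PassesInRound : {n : ℕ} → Graph n → Config n → Fin n → ℕ → Set
PassesInRound G x v t = deg G v ≤ after G x t v

-- Candies are conserved, and a vertex v that once holds fewer than deg v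
-- candies holds fewer than 2 deg v ever after: passing leaves at most
-- x - deg v + deg v = x, and a stalled vertex receives at most deg v.
-- If every vertex stalled at some round, then at the latest of these
-- rounds all vertices hold fewer than 2 deg v candies and one holds fewer
-- than deg v, so c + |V| < 2 Σ deg = 4|E|, against the hypothesis.
-- Constructively we cannot search all rounds, but the configurations are
-- bounded by c, so the orbit is eventually periodic and it suffices to
-- look at the rounds before its first repetition.
module Submission where

open import Defs
open import Data.Nat using (ℕ; zero; suc; _+_; _*_; _∸_; _^_; _≤_; _<_; _≤′_; ≤′-refl; ≤′-step; _≤ᵇ_; z≤n; s≤s; _<?_)
open import Data.Nat.Properties
open import Data.Nat.Induction using (<-rec)
open import Data.Nat.ListAction using (sum)
open import Data.Bool using (Bool; true; false; if_then_else_; T)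
open import Data.Fin as Fin using (Fin; toℕ; fromℕ<; funToFin; finToFun)
open import Data.Fin.Properties using (pigeonhole; toℕ-fromℕ<; finToFun-funToFin; all?; ¬∀⟶∃¬)
open import Data.List using ([]; _∷_; map; length)
open import Data.List.Properties using (map-cong; length-tabulate)
open import Data.List.Membership.Propositional using (_∈_)
open import Data.List.Membership.Propositional.Properties using (∈-allFin)
open import Data.List.Relation.Unary.Any using (here; there)
import Data.List.Relation.Unary.All as All
open import Data.List.Extrema.Nat using (argmax; f[xs]≤f[argmax])
open import Data.Product using (∃; ∃₂; _×_; _,_; proj₁; proj₂)
open import Data.Empty using (⊥-elim)
open import Relation.Nullary using (¬_; Dec; yes; no)
open import Relation.Binary.PropositionalEquality
open import Algebra.Properties.CommutativeSemigroup +-commutativeSemigroup using (interchange)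

module _ {A : Set} where

  sum-map-cong : {f g : A → ℕ} → f ≗ g → ∀ xs → sum (map f xs) ≡ sum (map g xs)
  sum-map-cong f≗g xs = cong sum (map-cong f≗g xs)

  sum-map-zero : {f : A → ℕ} → (∀ a → f a ≡ 0) → ∀ xs → sum (map f xs) ≡ 0
  sum-map-zero f≡0 []       = refl
  sum-map-zero f≡0 (x ∷ xs) = cong₂ _+_ (f≡0 x) (sum-map-zero f≡0 xs)

  sum-map-+ : (f g : A → ℕ) → ∀ xs → sum (map (λ a → f a + g a) xs) ≡ sum (map f xs) + sum (map g xs)
  sum-map-+ f g []       = refl
  sum-map-+ f g (x ∷ xs) =
    trans (cong (f x + g x +_) (sum-map-+ f g xs)) (interchange (f x) (g x) _ _)

  sum-map-suc : (f : A → ℕ) → ∀ xs → sum (map (λ a → suc (f a)) xs) ≡ sum (map f xs) + length xs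
  sum-map-suc f []       = refl
  sum-map-suc f (x ∷ xs) = begin
    suc (f x + sum (map (λ a → suc (f a)) xs)) ≡⟨ cong (λ s → suc (f x + s)) (sum-map-suc f xs) ⟩
    suc (f x + (sum (map f xs) + length xs))   ≡⟨ cong suc (+-assoc (f x) _ _) ⟨
    suc (f x + sum (map f xs) + length xs)     ≡⟨ +-suc _ (length xs) ⟨
    f x + sum (map f xs) + suc (length xs)     ∎
    where open ≡-Reasoning

  sum-map-mono : {f g : A → ℕ} → (∀ a → f a ≤ g a) → ∀ xs → sum (map f xs) ≤ sum (map g xs)
  sum-map-mono f≤g []       = ≤-refl
  sum-map-mono f≤g (x ∷ xs) = +-mono-≤ (f≤g x) (sum-map-mono f≤g xs)

  sum-map-mono-< : {f g : A → ℕ} → (∀ a → f a ≤ g a) → ∀ {a xs} → a ∈ xs → f a < g a →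
                   sum (map f xs) < sum (map g xs)
  sum-map-mono-< f≤g {xs = _ ∷ xs} (here refl) fa<ga = +-mono-<-≤ fa<ga (sum-map-mono f≤g xs)
  sum-map-mono-< f≤g {xs = x ∷ _}  (there a∈xs) fa<ga = +-mono-≤-< (f≤g x) (sum-map-mono-< f≤g a∈xs fa<ga)

  ∈⇒≤sum-map : (f : A → ℕ) → ∀ {a xs} → a ∈ xs → f a ≤ sum (map f xs)
  ∈⇒≤sum-map f {xs = x ∷ xs} (here refl)  = m≤m+n (f x) _
  ∈⇒≤sum-map f {xs = x ∷ xs} (there a∈xs) = ≤-trans (∈⇒≤sum-map f a∈xs) (m≤n+m _ (f x))

sum-map-comm : {A B : Set} (f : A → B → ℕ) → ∀ xs ys →
  sum (map (λ a → sum (map (f a) ys)) xs) ≡ sum (map (λ b → sum (map (λ a → f a b) xs)) ys)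
sum-map-comm f []       ys = sym (sum-map-zero (λ _ → refl) ys)
sum-map-comm f (x ∷ xs) ys =
  trans (cong (sum (map (f x) ys) +_) (sum-map-comm f xs ys))
        (sym (sum-map-+ (f x) (λ b → sum (map (λ a → f a b) xs)) ys))

bounded-sequence-repeats : ∀ {n} c (s : ℕ → Fin n → ℕ) → (∀ t v → s t v ≤ c) →
                           ∃₂ λ i j → i < j × s i ≗ s j
bounded-sequence-repeats {n} c s s≤c =
  let i , j , i<j , same-code = pigeonhole ≤-refl code in
  toℕ i , toℕ j , i<j , λ v →
    trans (sym (decode i v)) (trans (cong (λ k → toℕ (finToFun k v)) same-code) (decode j v))
  where
  digits : ∀ t → Fin n → Fin (suc c)
  digits t v = fromℕ< (s≤s (s≤c t v))

  code : Fin (suc (suc c ^ n)) → Fin (suc c ^ n)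
  code t = funToFin (digits (toℕ t))

  decode : ∀ t v → toℕ (finToFun (code t) v) ≡ s (toℕ t) v
  decode t v = trans (cong toℕ (finToFun-funToFin (digits (toℕ t)) v)) (toℕ-fromℕ< _)

module CandyGame {n : ℕ} (G : Graph n) where

  Stalls : Config n → Fin n → ℕ → Set
  Stalls x v t = after G x t v < deg G v

  passes⇒deg≤ : ∀ x v → passes? G x v ≡ true → deg G v ≤ x v
  passes⇒deg≤ x v eq = ≤ᵇ⇒≤ (deg G v) (x v) (subst T (sym eq) _)

  ¬passes⇒<deg : ∀ x v → passes? G x v ≡ false → x v < deg G v
  ¬passes⇒<deg x v eq = ≰⇒> λ deg≤ → subst T eq (≤⇒≤ᵇ deg≤)

  indicator : Bool → ℕ
  indicator b = if b then 1 else 0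

  given : Config n → Fin n → ℕ
  given x v = if passes? G x v then deg G v else 0

  received : Config n → Fin n → ℕ
  received x v = Σv (λ u → if adj G u v then indicator (passes? G x u) else 0)

  received≤deg : ∀ x v → received x v ≤ deg G v
  received≤deg x v = sum-map-mono (λ u → edge-bound (passes? G x u) u) (vertices n)
    where
    edge-bound : ∀ b u → (if adj G u v then indicator b else 0) ≤ indicator (adj G v u)
    edge-bound b u rewrite symm G u v with adj G v u | b
    ... | true  | true  = ≤-refl
    ... | true  | false = z≤n
    ... | false | _     = ≤-refl

  step<2deg : ∀ x v → x v < deg G v + deg G v → step G x v < deg G v + deg G v
  step<2deg x v x<2d with passes? G x v in eq
  ... | true  = ≤-<-trans (≤-trans (+-monoʳ-≤ (x v ∸ deg G v) (received≤deg x v))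
                                   (≤-reflexive (m∸n+n≡m (passes⇒deg≤ x v eq))))
                          x<2d
  ... | false = +-mono-<-≤ (¬passes⇒<deg x v eq) (received≤deg x v)

  <2deg-after-stall : ∀ x v {s t} → Stalls x v s → s ≤ t → after G x t v < deg G v + deg G v
  <2deg-after-stall x v {s} stall s≤t = go (≤⇒≤′ s≤t)
    where
    go : ∀ {t} → s ≤′ t → after G x t v < deg G v + deg G v
    go ≤′-refl                 = <-≤-trans stall (m≤m+n _ _)
    go {suc t} (≤′-step s≤′t) = step<2deg (after G x t) v (go s≤′t)

  step+given≡x+received : ∀ x v → step G x v + given x v ≡ x v + received x v
  step+given≡x+received x v with passes? G x v in eq
  ... | true = begin
      x v ∸ deg G v + received x v + deg G v   ≡⟨ +-assoc (x v ∸ deg G v) _ _ ⟩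
      x v ∸ deg G v + (received x v + deg G v) ≡⟨ cong (x v ∸ deg G v +_) (+-comm (received x v) _) ⟩
      x v ∸ deg G v + (deg G v + received x v) ≡⟨ +-assoc (x v ∸ deg G v) _ _ ⟨
      x v ∸ deg G v + deg G v + received x v   ≡⟨ cong (_+ received x v) (m∸n+n≡m (passes⇒deg≤ x v eq)) ⟩
      x v + received x v                       ∎
    where open ≡-Reasoning
  ... | false = +-identityʳ _

  total-received≡total-given : ∀ x → total (received x) ≡ total (given x)
  total-received≡total-given x =
    trans (sum-map-comm (λ v u → if adj G u v then indicator (passes? G x u) else 0) (vertices n) (vertices n))
          (sum-map-cong sent (vertices n))
    where
    sent : ∀ u → Σv (λ v → if adj G u v then indicator (passes? G x u) else 0) ≡ given x u
    sent u with passes? G x u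
    ... | true  = refl
    ... | false = sum-map-zero (λ v → if-0 (adj G u v)) (vertices n)
      where
      if-0 : ∀ b → (if b then 0 else 0) ≡ 0
      if-0 true  = refl
      if-0 false = refl

  total-step : ∀ x → total (step G x) ≡ total x
  total-step x = +-cancelʳ-≡ (total (given x)) _ _ (begin
      total (step G x) + total (given x)          ≡⟨ sum-map-+ (step G x) (given x) (vertices n) ⟨
      Σv (λ v → step G x v + given x v)           ≡⟨ sum-map-cong (step+given≡x+received x) (vertices n) ⟩
      Σv (λ v → x v + received x v)               ≡⟨ sum-map-+ x (received x) (vertices n) ⟩
      total x + total (received x)                ≡⟨ cong (total x +_) (total-received≡total-given x) ⟩
      total x + total (given x)                   ∎)
    where open ≡-Reasoning

  total-after : ∀ x t → total (after G x t) ≡ total x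
  total-after x zero    = refl
  total-after x (suc t) = trans (total-step (after G x t)) (total-after x t)

  after≤total : ∀ x t v → after G x t v ≤ total x
  after≤total x t v = ≤-trans (∈⇒≤sum-map (after G x t) (∈-allFin v)) (≤-reflexive (total-after x t))

  step-cong : ∀ {x y} → x ≗ y → step G x ≗ step G y
  step-cong {x} {y} x≗y v =
    cong₂ _+_ (cong₂ (λ a b → a ∸ (if b then deg G v else 0)) (x≗y v) (same-passes v))
              (sum-map-cong (λ u → cong (λ b → if adj G u v then indicator b else 0) (same-passes u)) (vertices n))
    where
    same-passes : ∀ u → passes? G x u ≡ passes? G y u
    same-passes u = cong (deg G u ≤ᵇ_) (x≗y u)

  after-periodic : ∀ x {i j} → i < j → after G x i ≗ after G x j →
                   ∀ t → ∃ λ t′ → t′ < j × after G x t ≗ after G x t′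
  after-periodic x {i} {j} i<j repeat = <-rec _ reduce
    where
    shifted : ∀ k → after G x (k + i) ≗ after G x (k + j)
    shifted zero    = repeat
    shifted (suc k) = step-cong (shifted k)

    reduce : ∀ t → (∀ {s} → s < t → ∃ λ t′ → t′ < j × after G x s ≗ after G x t′) →
             ∃ λ t′ → t′ < j × after G x t ≗ after G x t′
    reduce t earlier with t <? j
    ... | yes t<j = t , t<j , λ _ → refl
    ... | no  t≮j = let t′ , t′<j , same = earlier k+i<t in t′ , t′<j , λ v →
      trans (cong (λ s → after G x s v) (sym k+j≡t)) (trans (sym (shifted k v)) (same v))
      where
      k = t ∸ j
      k+j≡t : k + j ≡ t
      k+j≡t = m∸n+n≡m (≮⇒≥ t≮j)
      k+i<t : k + i < t
      k+i<t = subst (k + i <_) k+j≡t (+-monoʳ-< k i<j)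

  total+n<2·twiceEdges : ∀ y w → (∀ v → y v < deg G v + deg G v) → y w < deg G w →
                         total y + n < 2 * twiceEdges G
  total+n<2·twiceEdges y w y<2deg yw<deg = subst₂ _<_ lhs rhs
    (sum-map-mono-< y<2deg (∈-allFin w) (<-≤-trans (s≤s yw<deg) (m<m+n _ (≤-<-trans z≤n yw<deg))))
    where
    lhs : Σv (λ v → suc (y v)) ≡ total y + n
    lhs = trans (sum-map-suc y (vertices n)) (cong (total y +_) (length-tabulate (λ v → v)))
    rhs : Σv (λ v → deg G v + deg G v) ≡ 2 * twiceEdges G
    rhs = trans (sum-map-+ (deg G) (deg G) (vertices n)) (cong (twiceEdges G +_) (sym (+-identityʳ _)))

  ¬all-stall : ∀ x → Fin n → 2 * twiceEdges G ≤ total x + n → ¬ (∀ v → ∃ (Stalls x v))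
  ¬all-stall x v₀ 4|E|≤c+n stalls =
    <⇒≱ (total+n<2·twiceEdges (after G x last) w below-2deg (proj₂ (stalls w)))
        (subst (λ c → 2 * twiceEdges G ≤ c + n) (sym (total-after x last)) 4|E|≤c+n)
    where
    stall-round : Fin n → ℕ
    stall-round v = proj₁ (stalls v)
    w = argmax stall-round v₀ (vertices n)
    last = stall-round w
    below-2deg : ∀ v → after G x last v < deg G v + deg G v
    below-2deg v = <2deg-after-stall x v (proj₂ (stalls v))
                     (All.lookup (f[xs]≤f[argmax] {f = stall-round} v₀ (vertices n)) (∈-allFin v))

  stalls-before? : ∀ x h v → Dec (∃ λ t → t < h × Stalls x v t)
  stalls-before? x h v = anyUpTo? (λ t → after G x t v <? deg G v) h

  passes-until : ∀ x → Fin n → 2 * twiceEdges G ≤ total x + n →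
                 ∀ h → ∃ λ v → ∀ {t} → t < h → PassesInRound G x v t
  passes-until x v₀ 4|E|≤c+n h with all? (stalls-before? x h)
  ... | yes stalls  = ⊥-elim (¬all-stall x v₀ 4|E|≤c+n λ v → let t , _ , stall = stalls v in t , stall)
  ... | no ¬stalls with ¬∀⟶∃¬ n _ (stalls-before? x h) ¬stalls
  ...   | v , never = v , λ t<h → ≮⇒≥ λ stall → never (_ , t<h , stall)

open CandyGame

lemma2 : (n : ℕ) (G : Graph n) (c : ℕ) → 0 < c → 2 * twiceEdges G ≤ c + n →
         (x : Config n) → total x ≡ c →
         ∃ λ (v : Fin n) → ∀ (t : ℕ) → PassesInRound G x v t
lemma2 zero    _ _ () _ _ refl
lemma2 (suc _) G c _ 4|E|≤c+n x refl
  with i , j , i<j , repeat ← bounded-sequence-repeats c (after G x) (after≤total G x)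
  with v , passes ← passes-until G x Fin.zero 4|E|≤c+n j
  = v , λ t → let t′ , t′<j , same = after-periodic G x i<j repeat t in
              subst (deg G v ≤_) (sym (same v)) (passes t′<j)
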